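{- For every integer $n\ge 2$, with $t_m=m(m+1)/2$ denoting the $m$-th triangular number, $$ g(t_n,t_{n+1},t_{n+2};1)=n(n+1)(n+2)-1\,. $$
   Context: For positive integers $a_1,\dots,a_k$ with $\gcd(a_1,\dots,a_k)=1$ and an integer $N$, let $d(N;a_1,\dots,a_k)$ denote the number of $k$-tuples $(x_1,\dots,x_k)$ of nonnegative integers with $a_1x_1+\cdots+a_kx_k=N$. For a nonnegative integer $q$, $g(a_1,\dots,a_k;q)$ denotes the largest integer $N$ such that $d(N;a_1,\dots,a_k)\le q$. It is known that $\gcd(t_n,t_{n+1},t_{n+2})=1$. -}

module Defs where

open import Data.Nat using (ℕ; zero; suc; _+_; _*_; _≤_; _<_; _/_)
open import Data.Nat.Properties using (_≟_)
open import Data.List using (List; []; _∷_; length; filter; map; concatMap; upTo; zipWith)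
open import Data.Nat.ListAction using (sum)
open import Relation.Nullary.Decidable using (⌊_⌋)
open import Relation.Binary.PropositionalEquality using (_≡_)

tuples : ℕ → ℕ → List (List ℕ)
tuples zero    B = [] ∷ []
tuples (suc k) B = concatMap (λ x → map (x ∷_) (tuples k B)) (upTo (suc B))

dot : List ℕ → List ℕ → ℕ
dot as xs = sum (zipWith _*_ as xs)

-- Since all aᵢ ≥ 1 (positive integers), any
-- solution has every xᵢ ≤ N, so enumerating tuples with entries in
-- {0,…,N} counts all solutions.  (Only N ≥ 0 is needed.)
d : ℕ → List ℕ → ℕ
d N as = length (filter (λ xs → dot as xs ≟ N) (tuples (length as) N))

-- "g(a₁,…,a_k; q) = M": M is the largest integer N with d(N; a) ≤ q.
-- For negative N, d = 0 ≤ q, so when M ≥ 0 it suffices to quantify over ℕ.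
IsG : List ℕ → ℕ → ℕ → Set
IsG as q M = d M as ≤ q × (∀ N → M < N → q < d N as)
  where open import Data.Product using (_×_)

t : ℕ → ℕ
t m = (m * suc m) / 2

-- Put U = u + 1, W = w + 1 and take the weights A = UW, B = (U + 1)W, C = 1 + ρW.
-- Modulo W a representation xA + yB + zC of N determines z, and what remains is a
-- representation x·U + y·(U + 1) of a number by two consecutive coins, where the
-- exchange (U + 1)·U = U·(U + 1) is the only ambiguity. So M = UA + uB + wC, whose
-- coin part S = U·U + u·(U + 1) lies just below 2U² (beyond which U + 1 copies of U
-- can always be exchanged), is represented only as (U, u, w) unless a carry in z can
-- be absorbed; and every N > M is N₂W + lC with l ≤ w and N₂ > S, hence has two
-- representations. For n = 2U and for n = 2U − 1 the numbers t_n, t_{n+1}, t_{n+2}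
-- are such weights (in some order) with W = 2U + 1, and then M = n(n + 1)(n + 2) − 1.

module Submission where

open import Defs
open import Data.Nat using (ℕ; zero; suc; _+_; _*_; _∸_; _≤_; _<_; _%_; _/_; z≤n; s≤s; NonZero)
open import Data.Nat.Properties
open import Data.Nat.DivMod using (m≡m%n+[m/n]*n; m%n<n; [m+kn]%n≡m%n; m<n⇒m%n≡m; m*n/n≡m)
open import Data.Nat.Tactic.RingSolver using (solve-∀)
open import Data.List using (List; []; _∷_; length; filter; map; upTo)
open import Data.List.Membership.Propositional using (_∈_; find; lose)
open import Data.List.Membership.Propositional.Properties
  using (∈-concatMap⁻; ∈-concatMap⁺; ∈-map⁻; ∈-map⁺; ∈-upTo⁺; ∈-filter⁺; ∈-filter⁻; ∈-length)
open import Data.List.Relation.Unary.Any using (here; there)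
open import Data.List.Relation.Unary.All as All using (All; []; _∷_)
import Data.List.Relation.Unary.All.Properties as All
open import Data.List.Relation.Unary.AllPairs as AllPairs using ([]; _∷_)
import Data.List.Relation.Unary.AllPairs.Properties as AllPairs
open import Data.List.Relation.Unary.Unique.Propositional using (Unique)
import Data.List.Relation.Unary.Unique.Propositional.Properties as Unique
open import Data.Product using (∃; ∃₂; _×_; _,_; proj₁)
open import Data.Sum using (_⊎_; inj₁; inj₂)
open import Function using (_∘_)
open import Relation.Nullary using (¬_; contradiction)
open import Relation.Binary.PropositionalEquality

∈-tuples⁺ : ∀ {k B xs} → length xs ≡ k → All (_≤ B) xs → xs ∈ tuples k B
∈-tuples⁺ {xs = []} refl [] = here refl
∈-tuples⁺ {suc k} {B} {x ∷ xs} refl (x≤B ∷ xs≤B) =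
  ∈-concatMap⁺ (λ y → map (y ∷_) (tuples k B))
    (lose (∈-upTo⁺ (s≤s x≤B)) (∈-map⁺ (x ∷_) (∈-tuples⁺ refl xs≤B)))

∈-tuples⁻ : ∀ {k B xs} → xs ∈ tuples k B → length xs ≡ k
∈-tuples⁻ {zero} (here refl) = refl
∈-tuples⁻ {suc k} {B} xs∈ with find (∈-concatMap⁻ (λ y → map (y ∷_) (tuples k B)) {xs = upTo (suc B)} xs∈)
... | x , _ , xs∈xs∷tuples with ∈-map⁻ (x ∷_) xs∈xs∷tuples
... | ys , ys∈ , refl = cong suc (∈-tuples⁻ ys∈)

tuples-unique : ∀ k B → Unique (tuples k B)
tuples-unique zero B = [] ∷ []
tuples-unique (suc k) B =
  Unique.concat⁺ (All.map⁺ (All.tabulate λ _ → Unique.map⁺ ∷-injectiveʳ (tuples-unique k B)))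
    (AllPairs.map⁺ (AllPairs.map disjoint (Unique.upTo⁺ (suc B))))
  where
  ∷-injectiveʳ : ∀ {xs ys} {x : ℕ} → x ∷ xs ≡ x ∷ ys → xs ≡ ys
  ∷-injectiveʳ refl = refl
  disjoint : ∀ {x y} → x ≢ y → ∀ {v} → ¬ (v ∈ map (x ∷_) (tuples k B) × v ∈ map (y ∷_) (tuples k B))
  disjoint {x} {y} x≢y (v∈x∷ , v∈y∷) with ∈-map⁻ (x ∷_) v∈x∷ | ∈-map⁻ (y ∷_) v∈y∷
  ... | _ , _ , refl | _ , _ , refl = x≢y refl

Solution : List ℕ → ℕ → List ℕ → Set
Solution as N xs = length xs ≡ length as × dot as xs ≡ N

AtMostOneSolution : List ℕ → ℕ → Set
AtMostOneSolution as N = ∀ {xs ys} → Solution as N xs → Solution as N ys → xs ≡ ys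

TwoSolutions : List ℕ → ℕ → Set
TwoSolutions as N = ∃₂ λ xs ys → Solution as N xs × Solution as N ys × xs ≢ ys

solutions : List ℕ → ℕ → List (List ℕ)
solutions as N = filter (λ xs → dot as xs ≟ N) (tuples (length as) N)

dot-bounds : ∀ {as xs} → All NonZero as → length xs ≡ length as → All (_≤ dot as xs) xs
dot-bounds {[]} {[]} [] _ = []
dot-bounds {a ∷ as} {x ∷ xs} (a≢0 ∷ as≢0) eq =
  ≤-trans (m≤n*m x a {{a≢0}}) (m≤m+n (a * x) (dot as xs))
  ∷ All.map (λ xᵢ≤ → ≤-trans xᵢ≤ (m≤n+m (dot as xs) (a * x))) (dot-bounds as≢0 (suc-injective eq))

∈-solutions⁻ : ∀ {as N xs} → xs ∈ solutions as N → Solution as N xs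
∈-solutions⁻ {as} {N} xs∈ with ∈-filter⁻ (λ xs → dot as xs ≟ N) xs∈
... | xs∈tuples , dot≡N = ∈-tuples⁻ xs∈tuples , dot≡N

∈-solutions⁺ : ∀ {as N xs} → All NonZero as → Solution as N xs → xs ∈ solutions as N
∈-solutions⁺ as≢0 (len , refl) = ∈-filter⁺ _ (∈-tuples⁺ len (dot-bounds as≢0 len)) refl

length≤1 : ∀ {A : Set} {L : List A} → Unique L → (∀ {x y} → x ∈ L → y ∈ L → x ≡ y) → length L ≤ 1
length≤1 {L = []} _ _ = z≤n
length≤1 {L = _ ∷ []} _ _ = s≤s z≤n
length≤1 {L = _ ∷ _ ∷ _} ((x≢y ∷ _) ∷ _) allEqual = contradiction (allEqual (here refl) (there (here refl))) x≢y

1<length : ∀ {A : Set} {x y : A} {L} → x ∈ L → y ∈ L → x ≢ y → 1 < length L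
1<length (here refl) (here refl) x≢y = contradiction refl x≢y
1<length (here _) (there y∈) _ = s≤s (∈-length y∈)
1<length (there x∈) (here _) _ = s≤s (∈-length x∈)
1<length (there x∈) (there y∈) x≢y = m≤n⇒m≤1+n (1<length x∈ y∈ x≢y)

d≤1 : ∀ {as N} → AtMostOneSolution as N → d N as ≤ 1
d≤1 {as} {N} unique = length≤1 (Unique.filter⁺ _ (tuples-unique (length as) N))
  λ x∈ y∈ → unique (∈-solutions⁻ {as} x∈) (∈-solutions⁻ {as} y∈)

1<d : ∀ {as N} → All NonZero as → TwoSolutions as N → 1 < d N as
1<d as≢0 (_ , _ , sol , sol′ , xs≢ys) = 1<length (∈-solutions⁺ as≢0 sol) (∈-solutions⁺ as≢0 sol′) xs≢ys

Triple : Set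
Triple = ℕ × ℕ × ℕ

infix 7 _·_
_·_ : Triple → Triple → ℕ
(a , b , c) · (x , y , z) = a * x + b * y + c * z

toList : Triple → List ℕ
toList (x , y , z) = x ∷ y ∷ z ∷ []

rotate : Triple → Triple
rotate (x , y , z) = z , x , y

AtMostOneRep : Triple → ℕ → Set
AtMostOneRep v N = ∀ {x x′} → v · x ≡ N → v · x′ ≡ N → x ≡ x′

TwoReps : Triple → ℕ → Set
TwoReps v N = ∃₂ λ x x′ → v · x ≡ N × v · x′ ≡ N × x ≢ x′

IsGRep : Triple → ℕ → Set
IsGRep v M = AtMostOneRep v M × (∀ N → M < N → TwoReps v N)

toList-injective : ∀ {x y} → toList x ≡ toList y → x ≡ y
toList-injective refl = refl

rotate-injective : ∀ {x y} → rotate x ≡ rotate y → x ≡ y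
rotate-injective refl = refl

dot-toList : ∀ v x → dot (toList v) (toList x) ≡ v · x
dot-toList (a , b , c) (x , y , z) = begin
  a * x + (b * y + (c * z + 0)) ≡⟨ cong (λ r → a * x + (b * y + r)) (+-identityʳ (c * z)) ⟩
  a * x + (b * y + c * z)       ≡⟨ +-assoc (a * x) (b * y) (c * z) ⟨
  a * x + b * y + c * z         ∎
  where open ≡-Reasoning

·-rotate : ∀ v x → rotate v · rotate x ≡ v · x
·-rotate (a , b , c) (x , y , z) = trans (+-assoc (c * z) (a * x) (b * y)) (+-comm (c * z) (a * x + b * y))

solution-toList : ∀ {v N xs} → Solution (toList v) N xs → ∃ λ x → xs ≡ toList x × v · x ≡ N
solution-toList {v} {xs = x ∷ y ∷ z ∷ []} (_ , dot≡N) = (x , y , z) , refl , trans (sym (dot-toList v (x , y , z))) dot≡N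
solution-toList {xs = []} (() , _)
solution-toList {xs = _ ∷ []} (() , _)
solution-toList {xs = _ ∷ _ ∷ []} (() , _)
solution-toList {xs = _ ∷ _ ∷ _ ∷ _ ∷ _} (() , _)

IsGRep⇒IsG : ∀ {v M} → All NonZero (toList v) → IsGRep v M → IsG (toList v) 1 M
IsGRep⇒IsG {v} {M} v≢0 (unique , two) = d≤1 unique′ , λ N M<N → 1<d v≢0 (two′ N M<N)
  where
  unique′ : AtMostOneSolution (toList v) M
  unique′ {xs} {ys} sol sol′ with solution-toList {v} {M} {xs} sol | solution-toList {v} {M} {ys} sol′
  ... | _ , refl , rep | _ , refl , rep′ = cong toList (unique rep rep′)
  two′ : ∀ N → M < N → TwoSolutions (toList v) N
  two′ N M<N with two N M<N
  ... | x , x′ , rep , rep′ , x≢x′ =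
    toList x , toList x′ , (refl , trans (dot-toList v x) rep) , (refl , trans (dot-toList v x′) rep′) ,
    x≢x′ ∘ toList-injective

IsGRep-rotate : ∀ {v M} → IsGRep v M → IsGRep (rotate v) M
IsGRep-rotate {v} {M} (unique , two) = unique′ , two′
  where
  unique′ : AtMostOneRep (rotate v) M
  unique′ {z , x , y} {z′ , x′ , y′} rep rep′
    with unique (trans (sym (·-rotate v (x , y , z))) rep) (trans (sym (·-rotate v (x′ , y′ , z′))) rep′)
  ... | refl = refl
  two′ : ∀ N → M < N → TwoReps (rotate v) N
  two′ N M<N with two N M<N
  ... | x , x′ , rep , rep′ , x≢x′ =
    rotate x , rotate x′ , trans (·-rotate v x) rep , trans (·-rotate v x′) rep′ , x≢x′ ∘ rotate-injective

residue-cancel : ∀ {w s c X y X′ y′} → c ≡ suc (s * suc w) → y′ ≤ w →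
  X * suc w + y * c ≡ X′ * suc w + y′ * c →
  ∃ λ k → y ≡ y′ + k * suc w × X + k * c ≡ X′
residue-cancel {w} {s} {_} {X} {y} {X′} {y′} refl y′≤w eq = k , y≡ , X+kc≡X′
  where
  W = suc w
  c = suc (s * W)
  k = y / W
  shape : ∀ X y s w → X * suc w + y * suc (s * suc w) ≡ y + (X + y * s) * suc w
  shape = solve-∀
  y%W≡y′ : y % W ≡ y′
  y%W≡y′ = begin
    y % W                       ≡⟨ [m+kn]%n≡m%n y (X + y * s) W ⟨
    (y + (X + y * s) * W) % W   ≡⟨ cong (_% W) (trans (sym (shape X y s w)) (trans eq (shape X′ y′ s w))) ⟩
    (y′ + (X′ + y′ * s) * W) % W ≡⟨ [m+kn]%n≡m%n y′ (X′ + y′ * s) W ⟩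
    y′ % W                      ≡⟨ m<n⇒m%n≡m (s≤s y′≤w) ⟩
    y′                          ∎
    where open ≡-Reasoning
  y≡ : y ≡ y′ + k * W
  y≡ = trans (m≡m%n+[m/n]*n y W) (cong (_+ k * W) y%W≡y′)
  regroup : ∀ X k y′ s w →
    (X + k * suc (s * suc w)) * suc w + y′ * suc (s * suc w) ≡ X * suc w + (y′ + k * suc w) * suc (s * suc w)
  regroup = solve-∀
  X+kc≡X′ : X + k * c ≡ X′
  X+kc≡X′ = *-cancelʳ-≡ _ _ W (+-cancelʳ-≡ (y′ * c) _ _ (begin
    (X + k * c) * W + y′ * c ≡⟨ regroup X k y′ s w ⟩
    X * W + (y′ + k * W) * c ≡⟨ cong (λ y → X * W + y * c) y≡ ⟨
    X * W + y * c            ≡⟨ eq ⟩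
    X′ * W + y′ * c          ∎))
    where open ≡-Reasoning

module Consecutive (u : ℕ) where

  U : ℕ
  U = suc u

  S : ℕ
  S = U * U + u * suc U

  -- u * U = U(U − 1) is the conductor of the semigroup generated by U and U + 1.
  coins : ∀ m → u * U ≤ m → ∃₂ λ α β → α * U + β * suc U ≡ m
  coins m u*U≤m = q ∸ r , r , rep
    where
    r = m % U
    q = m / U
    r≤q : r ≤ q
    r≤q = ≮⇒≥ λ q<r → <⇒≱ (begin-strict
      m         ≡⟨ m≡m%n+[m/n]*n m U ⟩
      r + q * U <⟨ +-monoˡ-< (q * U) (m%n<n m U) ⟩
      U + q * U ≤⟨ *-monoˡ-≤ U (≤-trans q<r (≤-pred (m%n<n m U))) ⟩
      u * U     ∎) u*U≤m
      where open ≤-Reasoning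
    regroup : ∀ d r U → d * U + r * suc U ≡ r + (r + d) * U
    regroup = solve-∀
    rep : (q ∸ r) * U + r * suc U ≡ m
    rep = begin
      (q ∸ r) * U + r * suc U ≡⟨ regroup (q ∸ r) r U ⟩
      r + (r + (q ∸ r)) * U   ≡⟨ cong (λ p → r + p * U) (m+[n∸m]≡n r≤q) ⟩
      r + q * U               ≡⟨ m≡m%n+[m/n]*n m U ⟨
      m                       ∎
      where open ≡-Reasoning

  rep-S-unique : ∀ {x y} → x * U + y * suc U ≡ S → x ≡ U × y ≡ u
  rep-S-unique {x} {y} eq with residue-cancel {u} {1} (cong suc (sym (*-identityˡ U))) ≤-refl eq
  ... | zero , y≡ , x≡ = trans (sym (+-identityʳ x)) x≡ , trans y≡ (+-identityʳ u)
  ... | suc k , _ , x≡ = contradiction x≡ (<⇒≢ (<-≤-trans (n<1+n U) (≤-trans (m≤m+n (suc U) (k * suc U)) (m≤n+m _ x))) ∘ sym)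

  rep-above-S : ∀ {m} → S < m → ∃₂ λ α β → (suc U + α) * U + β * suc U ≡ m
  rep-above-S {m} S<m with coins (u * U + (m ∸ suc S)) (m≤m+n (u * U) (m ∸ suc S))
  ... | α , β , rep = α , β , (begin
    (suc U + α) * U + β * suc U   ≡⟨ extra-coins α β u ⟩
    U * suc U + (α * U + β * suc U) ≡⟨ cong (U * suc U +_) rep ⟩
    U * suc U + (u * U + e)       ≡⟨ +-assoc (U * suc U) (u * U) e ⟨
    U * suc U + u * U + e         ≡⟨ cong (_+ e) (1+S≡ u) ⟨
    suc S + e                     ≡⟨ m+[n∸m]≡n S<m ⟩
    m                             ∎)
    where
    open ≡-Reasoning
    e = m ∸ suc S
    extra-coins : ∀ α β u →
      (suc (suc u) + α) * suc u + β * suc (suc u) ≡ suc u * suc (suc u) + (α * suc u + β * suc (suc u))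
    extra-coins = solve-∀
    1+S≡ : ∀ u → suc (suc u * suc u + u * suc (suc u)) ≡ suc u * suc (suc u) + u * suc u
    1+S≡ = solve-∀

  exchange : ∀ α β → α * U + (U + β) * suc U ≡ (suc U + α) * U + β * suc U
  exchange α β = lemma α β U
    where
    lemma : ∀ α β U → α * U + (U + β) * suc U ≡ (suc U + α) * U + β * suc U
    lemma = solve-∀

module Triangular (u w ρ : ℕ) where
  open Consecutive u public

  W A B C : ℕ
  W = suc w
  A = U * W
  B = suc U * W
  C = suc (ρ * W)

  weights : Triple
  weights = A , B , C

  M : ℕ
  M = weights · (U , u , w)

  ·-factor : ∀ x y z → weights · (x , y , z) ≡ (x * U + y * suc U) * W + z * C
  ·-factor x y z = lemma U W C x y z
    where
    lemma : ∀ U W C x y z → U * W * x + suc U * W * y + C * z ≡ (x * U + y * suc U) * W + z * C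
    lemma = solve-∀

  M≡ : M ≡ S * W + w * C
  M≡ = ·-factor U u w

  -- residue-cancel puts the last coordinate of a representation of M at w + kW;
  -- NoCarry says that k ≥ 1 is impossible.
  NoCarry : Set
  NoCarry = ∀ k α β → α * U + β * suc U + suc k * C ≢ S

  rep-M : NoCarry → ∀ {x y z} → weights · (x , y , z) ≡ M → (x , y , z) ≡ (U , u , w)
  rep-M noCarry {x} {y} {z} rep
    with residue-cancel {w} {ρ} refl ≤-refl (trans (sym (·-factor x y z)) (trans rep M≡))
  ... | suc k , _ , carry = contradiction carry (noCarry k x y)
  ... | zero , z≡ , xy≡ with rep-S-unique (trans (sym (+-identityʳ _)) xy≡)
  ...   | x≡U , y≡u = cong₂ _,_ x≡U (cong₂ _,_ y≡u (trans z≡ (+-identityʳ w)))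

  decompose : ∀ {N} → M < N → ∃₂ λ l N₂ → S < N₂ × N₂ * W + l * C ≡ N
  decompose {N} M<N = l , N₂ , S<N₂ , N₂W+lC≡N
    where
    l = N % W
    l≤w : l ≤ w
    l≤w = ≤-pred (m%n<n N W)
    expand : ∀ a b ρ W → a * W + b * suc (ρ * W) ≡ b + (b * ρ + a) * W
    expand = solve-∀
    lρ≤N/W : l * ρ ≤ N / W
    lρ≤N/W = ≮⇒≥ λ N/W<lρ → <⇒≱ M<N (begin
      N                 ≡⟨ m≡m%n+[m/n]*n N W ⟩
      l + N / W * W     ≤⟨ +-monoʳ-≤ l (*-monoˡ-≤ W (<⇒≤ N/W<lρ)) ⟩
      l + l * ρ * W     ≡⟨ cong (λ q → l + q * W) (+-identityʳ (l * ρ)) ⟨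
      l + (l * ρ + 0) * W ≡⟨ expand 0 l ρ W ⟨
      0 * W + l * C     ≤⟨ *-monoˡ-≤ C l≤w ⟩
      w * C             ≤⟨ m≤n+m (w * C) (S * W) ⟩
      S * W + w * C     ≡⟨ M≡ ⟨
      M                 ∎)
      where open ≤-Reasoning
    N₂ = N / W ∸ l * ρ
    N₂W+lC≡N : N₂ * W + l * C ≡ N
    N₂W+lC≡N = begin
      N₂ * W + l * C        ≡⟨ expand N₂ l ρ W ⟩
      l + (l * ρ + N₂) * W  ≡⟨ cong (λ q → l + q * W) (m+[n∸m]≡n lρ≤N/W) ⟩
      l + N / W * W         ≡⟨ m≡m%n+[m/n]*n N W ⟨
      N                     ∎
      where open ≡-Reasoning
    S<N₂ : S < N₂
    S<N₂ = ≰⇒> λ N₂≤S → <⇒≱ M<N (begin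
      N              ≡⟨ N₂W+lC≡N ⟨
      N₂ * W + l * C ≤⟨ +-mono-≤ (*-monoˡ-≤ W N₂≤S) (*-monoˡ-≤ C l≤w) ⟩
      S * W + w * C  ≡⟨ M≡ ⟨
      M              ∎)
      where open ≤-Reasoning

  two-reps-from : ∀ {N N₂} l α β → N₂ * W + l * C ≡ N → (suc U + α) * U + β * suc U ≡ N₂ →
    TwoReps weights N
  two-reps-from l α β N₂W+lC≡N rep = (suc U + α , β , l) , (α , U + β , l) , rep₁ , rep₂ , distinct
    where
    rep₁ = trans (·-factor (suc U + α) β l) (trans (cong (λ m → m * W + l * C) rep) N₂W+lC≡N)
    rep₂ = trans (·-factor α (U + β) l) (trans (cong (λ m → m * W + l * C) (trans (exchange α β) rep)) N₂W+lC≡N)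
    distinct : (suc U + α , β , l) ≢ (α , U + β , l)
    distinct reps≡ = m≢1+n+m α (sym (cong proj₁ reps≡))

  two-reps : ∀ {N} → M < N → TwoReps weights N
  two-reps M<N =
    let l , N₂ , S<N₂ , N₂W+lC≡N = decompose M<N
        α , β , rep = rep-above-S S<N₂
    in two-reps-from l α β N₂W+lC≡N rep

  isGRep : NoCarry → IsGRep weights M
  isGRep noCarry = (λ rep rep′ → trans (rep-M noCarry rep) (sym (rep-M noCarry rep′))) , λ _ → two-reps

  noCarry-if-S<C : S < C → NoCarry
  noCarry-if-S<C S<C k α β carry = <⇒≱ S<C (begin
    C                             ≤⟨ m≤m+n C (k * C) ⟩
    suc k * C                     ≤⟨ m≤n+m (suc k * C) (α * U + β * suc U) ⟩
    α * U + β * suc U + suc k * C ≡⟨ carry ⟩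
    S                             ∎)
    where open ≤-Reasoning

  noCarry-if-S≡u+C : 0 < u → u < C → S ≡ u + C → NoCarry
  noCarry-if-S≡u+C 0<u u<C S≡u+C zero α β carry = no-small-rep α β (+-cancelʳ-≡ C _ _ (begin
    α * U + β * suc U + C       ≡⟨ cong (α * U + β * suc U +_) (*-identityˡ C) ⟨
    α * U + β * suc U + 1 * C   ≡⟨ carry ⟩
    S                           ≡⟨ S≡u+C ⟩
    u + C                       ∎))
    where
    open ≡-Reasoning
    no-small-rep : ∀ α β → α * U + β * suc U ≢ u
    no-small-rep zero zero = <⇒≢ 0<u
    no-small-rep (suc α) β rep =
      <⇒≱ (n<1+n u) (≤-trans (≤-trans (m≤m+n U (α * U)) (m≤m+n _ (β * suc U))) (≤-reflexive rep))
    no-small-rep zero (suc β) rep =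
      <⇒≱ (n<1+n u) (≤-trans (≤-trans (n≤1+n U) (m≤m+n (suc U) (β * suc U))) (≤-reflexive rep))
  noCarry-if-S≡u+C 0<u u<C S≡u+C (suc k) α β carry = <⇒≱ (+-monoˡ-< C u<C) (begin
    C + C                                 ≤⟨ +-monoʳ-≤ C (m≤m+n C (k * C)) ⟩
    suc (suc k) * C                       ≤⟨ m≤n+m (suc (suc k) * C) (α * U + β * suc U) ⟩
    α * U + β * suc U + suc (suc k) * C   ≡⟨ carry ⟩
    S                                     ≡⟨ S≡u+C ⟩
    u + C                                 ∎)
    where open ≤-Reasoning

t≡ : ∀ m {X} → m * suc m ≡ X * 2 → t m ≡ X
t≡ m {X} m[m+1]≡2X = trans (cong (_/ 2) m[m+1]≡2X) (m*n/n≡m X 2)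

TriangularFormula : ℕ → Set
TriangularFormula n = IsG (t n ∷ t (suc n) ∷ t (suc (suc n)) ∷ []) 1 (n * suc n * suc (suc n) ∸ 1)

-- n = 2U, W = n + 1: (t_n, t_{n+1}, t_{n+2}) = (UW, (U + 1)W, 1 + (U + 2)W).
module Even (u : ℕ) where
  open Triangular u (suc u + suc u) (suc (suc (suc u)))

  n : ℕ
  n = suc u + suc u

  entries : t n ∷ t (suc n) ∷ t (suc (suc n)) ∷ [] ≡ toList weights
  entries = cong₂ _∷_ (t≡ n (tA u)) (cong₂ _∷_ (t≡ (suc n) (tB u)) (cong₂ _∷_ (t≡ (suc (suc n)) (tC u)) refl))
    where
    tA : ∀ u → (suc u + suc u) * suc (suc u + suc u) ≡ suc u * suc (suc u + suc u) * 2
    tA = solve-∀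
    tB : ∀ u → suc (suc u + suc u) * suc (suc (suc u + suc u)) ≡ suc (suc u) * suc (suc u + suc u) * 2
    tB = solve-∀
    tC : ∀ u → suc (suc (suc u + suc u)) * suc (suc (suc (suc u + suc u)))
             ≡ suc (suc (suc (suc u)) * suc (suc u + suc u)) * 2
    tC = solve-∀

  product : n * suc n * suc (suc n) ≡ suc M
  product = lemma u
    where
    lemma : ∀ u → (suc u + suc u) * suc (suc u + suc u) * suc (suc (suc u + suc u))
      ≡ suc (suc u * suc (suc u + suc u) * suc u + suc (suc u) * suc (suc u + suc u) * u
             + suc (suc (suc (suc u)) * suc (suc u + suc u)) * (suc u + suc u))
    lemma = solve-∀

  S<C : S < C
  S<C = subst (S <_) (sym (lemma u)) (s≤s (m≤m+n S (5 * u + 8)))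
    where
    lemma : ∀ u → suc (suc (suc (suc u)) * suc (suc u + suc u))
                ≡ suc (suc u * suc u + u * suc (suc u) + (5 * u + 8))
    lemma = solve-∀

  claim : TriangularFormula n
  claim = subst₂ (λ as M → IsG as 1 M) (sym entries) (cong (_∸ 1) (sym product))
    (IsGRep⇒IsG {weights} (_ ∷ _ ∷ _ ∷ []) (isGRep (noCarry-if-S<C S<C)))

-- n = 2U − 1, W = n + 2: (t_n, t_{n+1}, t_{n+2}) = (1 + uW, UW, (U + 1)W).
module Odd (u : ℕ) where
  open Triangular u (suc u + suc u) u

  n : ℕ
  n = suc u + u

  entries : t n ∷ t (suc n) ∷ t (suc (suc n)) ∷ [] ≡ toList (rotate weights)
  entries = cong₂ _∷_ (t≡ n (tC u)) (cong₂ _∷_ (t≡ (suc n) (tA u)) (cong₂ _∷_ (t≡ (suc (suc n)) (tB u)) refl))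
    where
    tC : ∀ u → (suc u + u) * suc (suc u + u) ≡ suc (u * suc (suc u + suc u)) * 2
    tC = solve-∀
    tA : ∀ u → suc (suc u + u) * suc (suc (suc u + u)) ≡ suc u * suc (suc u + suc u) * 2
    tA = solve-∀
    tB : ∀ u → suc (suc (suc u + u)) * suc (suc (suc (suc u + u))) ≡ suc (suc u) * suc (suc u + suc u) * 2
    tB = solve-∀

  product : n * suc n * suc (suc n) ≡ suc M
  product = lemma u
    where
    lemma : ∀ u → (suc u + u) * suc (suc u + u) * suc (suc (suc u + u))
      ≡ suc (suc u * suc (suc u + suc u) * suc u + suc (suc u) * suc (suc u + suc u) * u
             + suc (u * suc (suc u + suc u)) * (suc u + suc u))
    lemma = solve-∀

  S≡u+C : S ≡ u + C
  S≡u+C = lemma u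
    where
    lemma : ∀ u → suc u * suc u + u * suc (suc u) ≡ u + suc (u * suc (suc u + suc u))
    lemma = solve-∀

  claim : 0 < u → TriangularFormula n
  claim 0<u = subst₂ (λ as M → IsG as 1 M) (sym entries) (cong (_∸ 1) (sym product))
    (IsGRep⇒IsG {rotate weights} (_ ∷ _ ∷ _ ∷ [])
      (IsGRep-rotate {weights} (isGRep (noCarry-if-S≡u+C 0<u (s≤s (m≤m*n u W)) S≡u+C))))

even-or-odd : ∀ m → ∃ λ k → m ≡ k + k ⊎ m ≡ suc (k + k)
even-or-odd zero = 0 , inj₁ refl
even-or-odd (suc m) with even-or-odd m
... | k , inj₁ m≡2k = k , inj₂ (cong suc m≡2k)
... | k , inj₂ m≡2k+1 = suc k , inj₁ (trans (cong suc m≡2k+1) (cong suc (sym (+-suc k k))))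

theorem2 : ∀ (n : ℕ) → 2 ≤ n →
    IsG (t n ∷ t (suc n) ∷ t (suc (suc n)) ∷ []) 1 (n * suc n * suc (suc n) ∸ 1)
theorem2 (suc (suc m)) (s≤s (s≤s z≤n)) with even-or-odd m
... | k , inj₁ refl = subst TriangularFormula (cong suc (+-suc k k)) (Even.claim k)
... | k , inj₂ refl = subst TriangularFormula (cong (suc ∘ suc) (+-suc k k)) (Odd.claim (suc k) (s≤s z≤n))
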